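{- Let $R,S\in\mathfrak{D}$ and $\mathfrak{D}'\subseteq\mathfrak{D}$, let $\mathcal{E}(R),\mathcal{E}(S)$ be the EV-systems of $R$ and $S$ with respect to $\mathfrak{D}'$, and let $\epsilon:\mathcal{E}(R)\to\mathcal{E}(S)$ be a strict homomorphism. Put $\eta_G(\xi):=\phi_S\circ\epsilon\circ\alpha^R_{G,\xi}$. Then for all $G\in\mathfrak{D}'$, $\xi\in\mathcal{S}(G,R)$ and $v\in V(G)$: $$\alpha^S_{G,\eta_G(\xi)}(v)_2\subseteq\epsilon(\alpha^R_{G,\xi}(v))_2\quad\text{and}\quad\alpha^S_{G,\eta_G(\xi)}(v)_3\subseteq\epsilon(\alpha^R_{G,\xi}(v))_3.$$
   Context: Digraphs $G=(V(G),A(G))$ have a finite nonempty vertex set, and $A(G)\subseteq V(G)\times V(G)$; loops are allowed. $N^{in}_G(v)=\{w\ne v:wv\in A(G)\}$ and $N^{out}_G(v)=\{w\ne v:vw\in A(G)\}$. A homomorphism maps arcs to arcs; it is strict if, in addition, it maps proper arcs ($v\neq w$) to proper arcs. $\mathcal{S}(G,H)$ is the set of strict homomorphisms. $\mathfrak{D}$ is a representative system of the isomorphism classes of finite digraphs. EV-system of $T\in\{R,S\}$ with respect to $\mathfrak{D}'$: - Vertex set $\mathcal{E}_o(T)=\{(v,D,U):v\in V(T),\ D\subseteq N^{in}_T(v),\ U\subseteq N^{out}_T(v)\}$, with components $\mathfrak{a}_1,\mathfrak{a}_2,\mathfrak{a}_3$. - $\phi_T(\mathfrak{a})=\mathfrak{a}_1$,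 a strict homomorphism $\mathcal{E}(T)\to T$. - $\alpha^T_{G,\xi}(v)=(\xi(v),\xi[N^{in}_G(v)],\xi[N^{out}_G(v)])$ for $G\in\mathfrak{D}'$ and $\xi\in\mathcal{S}(G,T)$. - $\mathfrak{a}\mathfrak{b}\in A(\mathcal{E}(T))$ iff there exist $G\in\mathfrak{D}'$, $\xi\in\mathcal{S}(G,T)$ and $vw\in A(G)$ with $\mathfrak{a}=\alpha^T_{G,\xi}(v)$ and $\mathfrak{b}=\alpha^T_{G,\xi}(w)$. $\eta_G(\xi)$ is a strict homomorphism $G\to S$. -}

module Defs where

open import Data.Nat using (ℕ; NonZero)
open import Data.Bool using (Bool; true; T)
open import Data.Unit using (tt)
open import Data.Fin using (Fin; _≟_)
open import Data.Fin.Properties using (any?)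
open import Data.Fin.Subset using (Subset; _∈_; _⊆_)
open import Data.Fin.Subset.Properties using (_∈?_)
open import Data.Vec using (tabulate; lookup)
open import Data.Vec.Properties using ([]=⇒lookup; lookup⇒[]=; lookup∘tabulate)
open import Data.Product using (Σ; ∃; _×_; _,_; proj₁; proj₂)
open import Relation.Nullary using (¬_; Dec; yes; no)
open import Relation.Nullary.Decidable using (⌊_⌋; _×-dec_; ¬?; toWitness; fromWitness)
open import Relation.Binary.PropositionalEquality using (_≡_; _≢_; refl; sym; trans; subst)

record Digraph : Set where
  field
    n         : ℕ
    .nonempty : NonZero n
    arc       : Fin n → Fin n → Bool

open Digraph public

V : Digraph → Set
V G = Fin (n G)

Arc : (G : Digraph) → V G → V G → Set
Arc G v w = T (arc G v w)

Nin : (G : Digraph) → V G → Subset (n G)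
Nin G v = tabulate λ w → ⌊ ¬? (w ≟ v) ×-dec Data.Bool.T? (arc G w v) ⌋

Nout : (G : Digraph) → V G → Subset (n G)
Nout G v = tabulate λ w → ⌊ ¬? (w ≟ v) ×-dec Data.Bool.T? (arc G v w) ⌋

image : ∀ {m k} → (Fin m → Fin k) → Subset m → Subset k
image f P = tabulate λ u → ⌊ any? (λ w → (w ∈? P) ×-dec (f w ≟ u)) ⌋

record StrictHom (G H : Digraph) : Set where
  constructor shom
  field
    fun    : V G → V H
    hom    : ∀ v w → Arc G v w → Arc H (fun v) (fun w)
    strict : ∀ v w → Arc G v w → v ≢ w → fun v ≢ fun w

open StrictHom public

mem-tab : ∀ {m} (g : Fin m → Bool) x → x ∈ tabulate g → T (g x)
mem-tab g x p = subst T (sym (trans (sym (lookup∘tabulate g x)) ([]=⇒lookup p))) tt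

tab-mem : ∀ {m} (g : Fin m → Bool) x → T (g x) → x ∈ tabulate g
tab-mem g x t = lookup⇒[]= x (tabulate g) (trans (lookup∘tabulate g x) (lemma (g x) t))
  where
  lemma : ∀ b → T b → b ≡ true
  lemma true _ = refl

image-Nin : ∀ {G H} (ξ : StrictHom G H) v → image (fun ξ) (Nin G v) ⊆ Nin H (fun ξ v)
image-Nin {G} {H} ξ v {x} p with toWitness (mem-tab _ x p)
... | w , w∈ , refl with toWitness (mem-tab _ w w∈)
... | w≢v , a = tab-mem _ (fun ξ w) (fromWitness (strict ξ w v a w≢v , hom ξ w v a))

image-Nout : ∀ {G H} (ξ : StrictHom G H) v → image (fun ξ) (Nout G v) ⊆ Nout H (fun ξ v)
image-Nout {G} {H} ξ v {x} p with toWitness (mem-tab _ x p)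
... | w , w∈ , refl with toWitness (mem-tab _ w w∈)
... | w≢v , a = tab-mem _ (fun ξ w) (fromWitness ((λ e → strict ξ v w a (λ e' → w≢v (sym e')) (sym e)) , hom ξ v w a))

DigraphClass : Set₁
DigraphClass = Digraph → Set

-- vertices of ℰ(T): triples (v, D, U) with D ⊆ N^in(v), U ⊆ N^out(v).
-- The side conditions are irrelevant, so equality of such vertices is
-- equality of the triples.
record EVertex (T : Digraph) : Set where
  constructor ev
  field
    a₁   : V T
    a₂   : Subset (n T)
    a₃   : Subset (n T)
    .a₂⊆ : a₂ ⊆ Nin T a₁
    .a₃⊆ : a₃ ⊆ Nout T a₁

open EVertex public

φ : (T : Digraph) → EVertex T → V T
φ T = a₁

α : (T G : Digraph) → StrictHom G T → V G → EVertex T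
α T G ξ v = ev (fun ξ v) (image (fun ξ) (Nin G v)) (image (fun ξ) (Nout G v))
               (image-Nin ξ v) (image-Nout ξ v)

-- the second and third components of α^T_{G,ξ}(v), for any vertex map ξ
-- (used when the map is only given as a function)
α₂ : (T G : Digraph) → (V G → V T) → V G → Subset (n T)
α₂ T G ξ v = image ξ (Nin G v)

α₃ : (T G : Digraph) → (V G → V T) → V G → Subset (n T)
α₃ T G ξ v = image ξ (Nout G v)

EArc : (𝔇' : DigraphClass) (T : Digraph) → EVertex T → EVertex T → Set
EArc 𝔇' T 𝔞 𝔟 =
  Σ Digraph λ G → 𝔇' G × Σ (StrictHom G T) λ ξ → Σ (V G) λ v → Σ (V G) λ w →
    Arc G v w × (𝔞 ≡ α T G ξ v) × (𝔟 ≡ α T G ξ w)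

IsStrictEHom : (𝔇' : DigraphClass) (R S : Digraph) → (EVertex R → EVertex S) → Set
IsStrictEHom 𝔇' R S ε =
  ∀ 𝔞 𝔟 → EArc 𝔇' R 𝔞 𝔟 → EArc 𝔇' S (ε 𝔞) (ε 𝔟) × (𝔞 ≢ 𝔟 → ε 𝔞 ≢ ε 𝔟)

η : (R S G : Digraph) → (EVertex R → EVertex S) → StrictHom G R → V G → V S
η R S G ε ξ v = φ S (ε (α R G ξ v))

-- An arc w → v of G with w ≠ v is sent by α^R_{G,ξ} to a proper arc of ℰ(R) (ξ is strict),
-- hence by ε to a proper arc of ℰ(S).  Every arc of ℰ(S) is α^S_{G',ξ'} of an arc w' → v'
-- of some G' ∈ 𝔇', necessarily with w' ≠ v'; so the first component ξ'(w') = η_G(ξ)(w)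
-- of the tail lies in ξ'[N^in(v')], the second component of the head ε(α^R_{G,ξ}(v)).
-- Dually for out-neighbourhoods and third components.
module Submission where

open import Defs
open import Data.Fin using (Fin)
open import Data.Fin.Subset using (Subset; _⊆_; _∈_)
open import Data.Product using (∃; _×_; _,_)
open import Relation.Nullary.Decidable using (toWitness; fromWitness)
open import Relation.Binary.PropositionalEquality using (_≡_; _≢_; refl; sym; cong; ≢-sym)

∈-image⁺ : ∀ {m k} (f : Fin m → Fin k) {P : Subset m} {x} → x ∈ P → f x ∈ image f P
∈-image⁺ f {x = x} x∈P = tab-mem _ (f x) (fromWitness (x , x∈P , refl))

∈-image⁻ : ∀ {m k} (f : Fin m → Fin k) {P : Subset m} {y} →
           y ∈ image f P → ∃ λ x → x ∈ P × f x ≡ y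
∈-image⁻ f {y = y} y∈ = toWitness (mem-tab _ y y∈)

∈-Nin⁺ : ∀ {G v w} → w ≢ v → Arc G w v → w ∈ Nin G v
∈-Nin⁺ {w = w} w≢v wv = tab-mem _ w (fromWitness (w≢v , wv))

∈-Nin⁻ : ∀ {G v w} → w ∈ Nin G v → w ≢ v × Arc G w v
∈-Nin⁻ {w = w} w∈ = toWitness (mem-tab _ w w∈)

∈-Nout⁺ : ∀ {G v w} → w ≢ v → Arc G v w → w ∈ Nout G v
∈-Nout⁺ {w = w} w≢v vw = tab-mem _ w (fromWitness (w≢v , vw))

∈-Nout⁻ : ∀ {G v w} → w ∈ Nout G v → w ≢ v × Arc G v w
∈-Nout⁻ {w = w} w∈ = toWitness (mem-tab _ w w∈)

α-EArc : ∀ 𝔇' T G (ξ : StrictHom G T) {v w} → 𝔇' G → Arc G v w →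
         EArc 𝔇' T (α T G ξ v) (α T G ξ w)
α-EArc 𝔇' T G ξ {v} {w} G∈𝔇' vw = G , G∈𝔇' , ξ , v , w , vw , refl , refl

α-strict : ∀ T G (ξ : StrictHom G T) {v w} → Arc G v w → v ≢ w → α T G ξ v ≢ α T G ξ w
α-strict T G ξ {v} {w} vw v≢w eq = strict ξ v w vw v≢w (cong a₁ eq)

module _ {𝔇' : DigraphClass} {T : Digraph} {𝔞 𝔟 : EVertex T} where

  proper-EArc⇒a₁∈a₂ : EArc 𝔇' T 𝔞 𝔟 → 𝔞 ≢ 𝔟 → a₁ 𝔞 ∈ a₂ 𝔟
  proper-EArc⇒a₁∈a₂ (G , _ , ξ , v , w , vw , refl , refl) 𝔞≢𝔟 =
    ∈-image⁺ (fun ξ) (∈-Nin⁺ {G} (λ v≡w → 𝔞≢𝔟 (cong (α T G ξ) v≡w)) vw)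

  proper-EArc⇒a₁∈a₃ : EArc 𝔇' T 𝔞 𝔟 → 𝔞 ≢ 𝔟 → a₁ 𝔟 ∈ a₃ 𝔞
  proper-EArc⇒a₁∈a₃ (G , _ , ξ , v , w , vw , refl , refl) 𝔞≢𝔟 =
    ∈-image⁺ (fun ξ) (∈-Nout⁺ {G} (λ w≡v → 𝔞≢𝔟 (cong (α T G ξ) (sym w≡v))) vw)

module _ {𝔇' : DigraphClass} {R S : Digraph} {ε : EVertex R → EVertex S}
         (ε-strict : IsStrictEHom 𝔇' R S ε)
         {G : Digraph} (G∈𝔇' : 𝔇' G) (ξ : StrictHom G R) where

  ε∘α-proper-EArc : ∀ {v w} → Arc G v w → v ≢ w →
    EArc 𝔇' S (ε (α R G ξ v)) (ε (α R G ξ w)) × ε (α R G ξ v) ≢ ε (α R G ξ w)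
  ε∘α-proper-EArc vw v≢w with ε-strict _ _ (α-EArc 𝔇' R G ξ G∈𝔇' vw)
  ... | arc , separates = arc , separates (α-strict R G ξ vw v≢w)

  α₂-η⊆a₂-ε : ∀ v → α₂ S G (η R S G ε ξ) v ⊆ a₂ (ε (α R G ξ v))
  α₂-η⊆a₂-ε v x∈ with ∈-image⁻ (η R S G ε ξ) x∈
  ... | w , w∈Nin , refl with ∈-Nin⁻ {G} w∈Nin
  ... | w≢v , wv with ε∘α-proper-EArc wv w≢v
  ... | arc , proper = proper-EArc⇒a₁∈a₂ arc proper

  α₃-η⊆a₃-ε : ∀ v → α₃ S G (η R S G ε ξ) v ⊆ a₃ (ε (α R G ξ v))
  α₃-η⊆a₃-ε v x∈ with ∈-image⁻ (η R S G ε ξ) x∈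
  ... | w , w∈Nout , refl with ∈-Nout⁻ {G} w∈Nout
  ... | w≢v , vw with ε∘α-proper-EArc vw (≢-sym w≢v)
  ... | arc , proper = proper-EArc⇒a₁∈a₃ arc proper

lemma6 : (𝔇' : DigraphClass) (R S : Digraph) (ε : EVertex R → EVertex S) →
    IsStrictEHom 𝔇' R S ε →
    (G : Digraph) → 𝔇' G → (ξ : StrictHom G R) → (v : V G) →
      (α₂ S G (η R S G ε ξ) v ⊆ a₂ (ε (α R G ξ v)))
      × (α₃ S G (η R S G ε ξ) v ⊆ a₃ (ε (α R G ξ v)))
lemma6 𝔇' R S ε ε-strict G G∈𝔇' ξ v =
  α₂-η⊆a₂-ε ε-strict G∈𝔇' ξ v , α₃-η⊆a₃-ε ε-strict G∈𝔇' ξ v
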